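{- Let $p\geq 1$, $r\geq 1$ and $n\geq 1$ be integers. Then the O-Fibonacci $(p,r)$-cube $O\Gamma^{(p,r)}_{n}$ is a non-trivial Cartesian product graph (i.e. $O\Gamma^{(p,r)}_{n}\cong G_1\Box G_2$ for some graphs $G_1,G_2$ each having at least two vertices) if and only if $p=1$ and $r\geq n\geq 2$.
   Context: For positive integers $p,r,n$, a binary word $a_1a_2\ldots a_n$ is an O-Fibonacci $(p,r)$-word if (1) between any two $1$s there are at least $p-1$ zeros (i.e. if $a_i=1$ then $a_{i+1}=\dots=a_{i+p-1}=0$), and (2) there are at most $r$ "consecutive" $1$s, where two $1$s are called consecutive when exactly $p-1$ zeros separate them; equivalently the word contains at most $r$ consecutive copies of $10^{p-1}$, i.e. it does not contain the factor $(10^{p-1})^{r}1$. The O-Fibonacci $(p,r)$-cube $O\Gamma^{(p,r)}_{n}$ is the subgraph of the hypercube $Q_n$ induced on the set of all O-Fibonacci $(p,r)$-words of length $n$; two words are adjacent iff they differ in exactly one coordinate. $G\Box H$ denotes the Cartesian product of graphs: vertex set $V(G)\times V(H)$, with $(g,h)\sim(g',h')$ iff ($g=g'$ and $hh'\in E(H)$) or ($h=h'$ and $gg'\in E(G)$). -}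

module Defs where

open import Data.Nat using (ℕ; zero; suc; _∸_; _+_)
open import Data.Bool using (Bool; true; false; _∧_; not; T)
open import Data.Bool.Properties using () renaming (_≟_ to _≟B_)
open import Data.List using (List; []; _∷_; _++_; replicate; concat; [_])
open import Data.Vec using (Vec; toList) renaming ([] to []ᵥ; _∷_ to _∷ᵥ_)
open import Data.Product using (Σ; _×_; _,_; proj₁)
open import Data.Sum using (_⊎_; inj₁; inj₂)
open import Relation.Binary.PropositionalEquality using (_≡_; _≢_; refl; trans; cong) renaming (sym to ≡-sym)
open import Relation.Nullary using (yes; no)
open import Relation.Nullary.Decidable using (⌊_⌋)
open import Data.List.Relation.Binary.Infix.Heterogeneous.Properties using (infix?)
open import Function.Bundles using (_⤖_; _⇔_; Bijection)
open import Data.Empty using (⊥; ⊥-elim)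

record Graph : Set₁ where
  field
    V      : Set
    Adj    : V → V → Set
    adj-sym : ∀ {x y} → Adj x y → Adj y x
    irrefl : ∀ {x} → Adj x x → ⊥

open Graph public

Nontrivial : Graph → Set
Nontrivial G = Σ (V G) λ x → Σ (V G) λ y → x ≢ y

_□_ : Graph → Graph → Graph
G □ H = record
  { V      = V G × V H
  ; Adj    = λ { (g , h) (g' , h') →
                 (g ≡ g' × Adj H h h') ⊎ (h ≡ h' × Adj G g g') }
  ; adj-sym = λ { (inj₁ (refl , a)) →
                   inj₁ (refl , adj-sym H a)
               ; (inj₂ (refl , a)) →
                   inj₂ (refl , adj-sym G a) }
  ; irrefl = λ { (inj₁ (_ , a)) → irrefl H a
               ; (inj₂ (_ , a)) → irrefl G a }
  }

_≅_ : Graph → Graph → Set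
G ≅ H = Σ (V G ⤖ V H) λ f →
          ∀ x y → Adj G x y ⇔ Adj H (Bijection.to f x) (Bijection.to f y)

zerosAhead : ℕ → List Bool → Bool
zerosAhead zero    _       = true
zerosAhead (suc k) []      = true
zerosAhead (suc k) (b ∷ w) = not b ∧ zerosAhead k w

separated : ℕ → List Bool → Bool
separated p []          = true
separated p (true ∷ w)  = zerosAhead (p ∸ 1) w ∧ separated p w
separated p (false ∷ w) = separated p w

forbidden : ℕ → ℕ → List Bool
forbidden p r = concat (replicate r (true ∷ replicate (p ∸ 1) false)) ++ [ true ]

noLongRun : ℕ → ℕ → List Bool → Bool
noLongRun p r w = not ⌊ infix? _≟B_ (forbidden p r) w ⌋

isOFib : (p r : ℕ) → List Bool → Bool
isOFib p r w = separated p w ∧ noLongRun p r w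

hamming : ∀ {n} → Vec Bool n → Vec Bool n → ℕ
hamming []ᵥ        []ᵥ        = 0
hamming (a ∷ᵥ u) (b ∷ᵥ v) with a ≟B b
... | yes _ = hamming u v
... | no  _ = suc (hamming u v)

OFibCube : (p r n : ℕ) → Graph
OFibCube p r n = record
  { V      = Σ (Vec Bool n) (λ w → T (isOFib p r (toList w)))
  ; Adj    = λ { (u , _) (v , _) → hamming u v ≡ 1 }
  ; adj-sym = λ {x} {y} → symH (proj₁ x) (proj₁ y)
  ; irrefl = λ {x} → irrH (proj₁ x)
  }
  where
  symH : ∀ {m} (u v : Vec Bool m) → hamming u v ≡ 1 → hamming v u ≡ 1
  symH u v e = trans (hsym u v) e
    where
    hsym : ∀ {m} (u v : Vec Bool m) → hamming v u ≡ hamming u v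
    hsym []ᵥ []ᵥ = refl
    hsym (a ∷ᵥ u) (b ∷ᵥ v) with a ≟B b | b ≟B a
    ... | yes _ | yes _ = hsym u v
    ... | no  _ | no  _ =
            cong suc (hsym u v)
    ... | yes e | no  ne =
            ⊥-elim (ne (≡-sym e))
    ... | no  ne | yes e =
            ⊥-elim (ne (≡-sym e))
  irrH : ∀ {m} (u : Vec Bool m) → hamming u u ≡ 1 → ⊥
  irrH u e = zero≢1 (trans (≡-sym (h0 u)) e)
    where
    zero≢1 : 0 ≡ 1 → ⊥
    zero≢1 ()
    h0 : ∀ {m} (u : Vec Bool m) → hamming u u ≡ 0
    h0 []ᵥ = refl
    h0 (a ∷ᵥ u) with a ≟B a
    ... | yes _ = h0 u
    ... | no ne = ⊥-elim (ne refl)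

NontrivialProduct : Graph → Set₁
NontrivialProduct G =
  Σ Graph λ G₁ → Σ Graph λ G₂ → Nontrivial G₁ × Nontrivial G₂ × (G ≅ (G₁ □ G₂))

module Submission where

-- (⇐) For p = 1 and n ≤ r every word is valid, so OΓ_n is the hypercube Q_n, which
-- splits as K₂ □ Q_{n−1} by separating the first letter.
--
-- (⇒) Fix OΓ_n ≅ G₁ □ G₂ with nontrivial factors. Every edge then has a direction (it
-- moves in G₁ or in G₂), two edges at a vertex in different directions span a square,
-- and opposite edges of a 4-cycle without diagonals are parallel. As OΓ_n is connected,
-- the zero word has edges in both directions; its neighbours are the unit words, so two
-- consecutive unit edges 0 — e_a and 0 — e_{a+1} differ in direction (whence n ≥ 2).
-- In the hypercube the only possible fourth corner of their square is e_a + e_{a+1},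
-- which is therefore valid: impossible for p ≥ 2. For p = 1 and r < n the two
-- directions are transported across square faces to a word Z of weight r − 1 inside a
-- block of r + 1 ones around a, a + 1, forcing the block Z + e_a + e_{a+1} ∋ 1^{r+1} to
-- be valid, again a contradiction.

open import Defs
open import Data.Nat using (ℕ; _≤_; _≥_)
open import Data.Product using (_×_)
open import Relation.Binary.PropositionalEquality using (_≡_)
open import Function.Bundles using (_⇔_)

open import Data.Nat using (zero; suc; _+_; _∸_; _⊓_; _<_; z≤n; s≤s)
open import Data.Nat.Properties
  using ( ≤-refl; ≤-trans; ≤-reflexive; ≤-pred; <⇒≤; <-trans; <-irrefl; ≮⇒≥; n<1+n; n≤1+n
        ; suc-injective; +-comm; +-suc; +-monoʳ-≤; m⊓n≤m; m⊓n≤n; ⊓-glb; +-distribʳ-⊓; m∸n+n≡m)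
open import Data.Bool using (Bool; true; false; T)
open import Data.Bool.Properties using (T-∧; T?; T-irrelevant; ¬-not)
open import Data.Fin using (Fin; zero; suc; toℕ; inject₁)
open import Data.Fin.Properties using (toℕ-inject₁; toℕ<n; ≤̄⇒inject₁<) renaming (<⇒≢ to <⇒≢ᶠ)
open import Data.Vec using (Vec; []; _∷_; lookup; replicate; _[_]≔_; toList)
open import Data.Vec.Properties
  using (lookup∘update; lookup∘update′; []≔-idempotent; []≔-commutes; []≔-lookup; lookup-replicate)
open import Data.List using (List; []; _∷_; _++_; [_])
import Data.List as List
open import Data.List.Relation.Binary.Infix.Heterogeneous using (Infix; here; there)
open import Data.List.Relation.Binary.Prefix.Heterogeneous using (Prefix)
open import Data.Product using (∃; ∃₂; _,_; proj₁; proj₂)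
import Data.Product
open import Data.Sum using (_⊎_; inj₁; inj₂)
import Data.Sum
open import Data.Empty using (⊥; ⊥-elim)
open import Relation.Nullary using (¬_)
open import Relation.Nullary.Decidable using (recompute; toWitnessFalse; fromWitnessFalse)
open import Relation.Binary.PropositionalEquality
  using (_≢_; refl; sym; trans; cong; cong₂; subst; subst₂; module ≡-Reasoning)
open import Relation.Binary.Construct.Closure.ReflexiveTransitive
  using (Star; ε; _◅_; _◅◅_; gmap; reverse)
open import Function.Bundles using (Bijection; Equivalence; mk⇔; mk↔ₛ′)
open import Function.Properties.Inverse using (↔⇒⤖)
open import Function.Construct.Composition using (_⇔-∘_)
open import Function.Construct.Identity using (⇔-id)
open import Function.Base using (_∘_)

Walk : (G : Graph) → V G → V G → Set
Walk G = Star (Adj G)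

Connected : Graph → Set
Connected G = ∀ x y → Walk G x y

connected-≅ : ∀ {G H} → G ≅ H → Connected G → Connected H
connected-≅ {G} {H} (bij , adj) conn x y =
  subst₂ (Walk H) (to∘to⁻ x) (to∘to⁻ y)
    (gmap to (λ {a} {b} → Equivalence.to (adj a b)) (conn (to⁻ x) (to⁻ y)))
  where
  open Bijection bij using (to; to⁻; strictlySurjective)
  to∘to⁻ : ∀ y → to (to⁻ y) ≡ y
  to∘to⁻ y = proj₂ (strictlySurjective y)

-- If every step of a walk either keeps the value of c or starts at a vertex whose
-- c-value satisfies Q, then the walk ends at the initial value of c unless Q holds
-- for it: the first step changing c starts where c still has its initial value.
walk-keeps-or-leaves : ∀ {I C : Set} {R : I → I → Set} (c : I → C) (Q : C → Set) →
  (∀ {x y} → R x y → c x ≡ c y ⊎ Q (c x)) →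
  ∀ {x y} → Star R x y → c y ≡ c x ⊎ Q (c x)
walk-keeps-or-leaves c Q step ε = inj₁ refl
walk-keeps-or-leaves c Q step (s ◅ w) with step s
... | inj₂ q = inj₂ q
... | inj₁ e with walk-keeps-or-leaves c Q step w
...   | inj₁ e′ = inj₁ (trans e′ (sym e))
...   | inj₂ q  = inj₂ (subst Q (sym e) q)

module _ {G₁ G₂ : Graph} where

  □-adj₂ : ∀ {g h g′ h′} → Adj (G₁ □ G₂) (g , h) (g′ , h′) → g ≡ g′ → Adj G₂ h h′
  □-adj₂ (inj₁ (_ , a)) _    = a
  □-adj₂ (inj₂ (_ , a)) refl = ⊥-elim (irrefl G₁ a)

  □-adj₁ : ∀ {g h g′ h′} → Adj (G₁ □ G₂) (g , h) (g′ , h′) → h ≡ h′ → Adj G₁ g g′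
  □-adj₁ (inj₂ (_ , a)) _    = a
  □-adj₁ (inj₁ (_ , a)) refl = ⊥-elim (irrefl G₂ a)

  □-step₁ : ∀ {q q′} → Adj (G₁ □ G₂) q q′ → proj₁ q ≡ proj₁ q′ ⊎ ∃ (Adj G₁ (proj₁ q))
  □-step₁ (inj₁ (e , _)) = inj₁ e
  □-step₁ (inj₂ (_ , a)) = inj₂ (_ , a)

  □-step₂ : ∀ {q q′} → Adj (G₁ □ G₂) q q′ → proj₂ q ≡ proj₂ q′ ⊎ ∃ (Adj G₂ (proj₂ q))
  □-step₂ (inj₂ (e , _)) = inj₁ e
  □-step₂ (inj₁ (_ , a)) = inj₂ (_ , a)

  -- In a connected product every coordinate of a nontrivial factor has a neighbour
  -- in that factor: a walk to a vertex with another such coordinate must leave it.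
  has-neighbour₁ : Connected (G₁ □ G₂) → Nontrivial G₁ → ∀ g h → ∃ (Adj G₁ g)
  has-neighbour₁ conn (a , b , a≢b) g h
    with leaves (conn (g , h) (a , h)) | leaves (conn (g , h) (b , h))
    where leaves = walk-keeps-or-leaves proj₁ (λ g → ∃ (Adj G₁ g)) □-step₁
  ... | inj₂ nb   | _         = nb
  ... | inj₁ _    | inj₂ nb   = nb
  ... | inj₁ a≡g  | inj₁ b≡g  = ⊥-elim (a≢b (trans a≡g (sym b≡g)))

  has-neighbour₂ : Connected (G₁ □ G₂) → Nontrivial G₂ → ∀ g h → ∃ (Adj G₂ h)
  has-neighbour₂ conn (a , b , a≢b) g h
    with leaves (conn (g , h) (g , a)) | leaves (conn (g , h) (g , b))
    where leaves = walk-keeps-or-leaves proj₂ (λ h → ∃ (Adj G₂ h)) □-step₂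
  ... | inj₂ nb   | _         = nb
  ... | inj₁ _    | inj₂ nb   = nb
  ... | inj₁ a≡h  | inj₁ b≡h  = ⊥-elim (a≢b (trans a≡h (sym b≡h)))

module ProductStructure {G G₁ G₂ : Graph} (φ : G ≅ (G₁ □ G₂)) where
  open Bijection (proj₁ φ) using (to; to⁻; injective; strictlySurjective)

  to∘to⁻ : ∀ q → to (to⁻ q) ≡ q
  to∘to⁻ q = proj₂ (strictlySurjective q)

  adj⇒ : ∀ {x y} → Adj G x y → Adj (G₁ □ G₂) (to x) (to y)
  adj⇒ {x} {y} = Equivalence.to (proj₂ φ x y)

  lift : ∀ x q → Adj (G₁ □ G₂) (to x) q → Adj G x (to⁻ q)
  lift x q a = Equivalence.from (proj₂ φ x (to⁻ q))
                 (subst (Adj (G₁ □ G₂) (to x)) (sym (to∘to⁻ q)) a)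

  -- Same₁ x y: x and y have the same G₁-coordinate, so an edge between them
  -- moves in the G₂-direction; Same₂ dually.
  Same₁ Same₂ : V G → V G → Set
  Same₁ x y = proj₁ (to x) ≡ proj₁ (to y)
  Same₂ x y = proj₂ (to x) ≡ proj₂ (to y)

  same-coordinates : ∀ {x y} → Same₁ x y → Same₂ x y → x ≡ y
  same-coordinates s t = injective (cong₂ _,_ s t)

  edge-direction : ∀ {x y} → Adj G x y → Same₁ x y ⊎ Same₂ x y
  edge-direction a with adj⇒ a
  ... | inj₁ (e , _) = inj₁ e
  ... | inj₂ (e , _) = inj₂ e

  edge-direction-unique : ∀ {x y} → Adj G x y → Same₁ x y → Same₂ x y → ⊥
  edge-direction-unique {x} a s t =
    irrefl G (subst (Adj G x) (sym (same-coordinates s t)) a)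

  both-directions : Connected G → Nontrivial G₁ → Nontrivial G₂ → ∀ x →
                    (∃ λ y → Adj G x y × Same₁ x y) × (∃ λ y → Adj G x y × Same₂ x y)
  both-directions conn nt₁ nt₂ x =
    (to⁻ q₂ , lift x q₂ (inj₁ (refl , a₂)) , sym (cong proj₁ (to∘to⁻ q₂))) ,
    (to⁻ q₁ , lift x q₁ (inj₂ (refl , a₁)) , sym (cong proj₂ (to∘to⁻ q₁)))
    where
    conn′ : Connected (G₁ □ G₂)
    conn′ = connected-≅ {G} {G₁ □ G₂} φ conn
    n₂ = has-neighbour₂ {G₁} {G₂} conn′ nt₂ (proj₁ (to x)) (proj₂ (to x))
    n₁ = has-neighbour₁ {G₁} {G₂} conn′ nt₁ (proj₁ (to x)) (proj₂ (to x))
    a₂ = proj₂ n₂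
    a₁ = proj₂ n₁
    q₂ = proj₁ (to x) , proj₁ n₂
    q₁ = proj₁ n₁ , proj₂ (to x)

  square : ∀ {z u w} → Adj G z u → Adj G z w → Same₁ z u → Same₂ z w →
           ∃ λ y → Adj G u y × Adj G w y × y ≢ z
  square {z} {u} {w} zu zw s t =
    to⁻ q ,
    lift u q (inj₂ (refl , subst (λ g → Adj G₁ g (proj₁ (to w))) s a₁)) ,
    lift w q (inj₁ (refl , subst (λ h → Adj G₂ h (proj₂ (to u))) t a₂)) ,
    λ y≡z → irrefl G₁ (subst (λ g → Adj G₁ g (proj₁ (to w)))
                         (trans (cong (λ v → proj₁ (to v)) (sym y≡z)) (cong proj₁ (to∘to⁻ q))) a₁)
    where
    q  = proj₁ (to w) , proj₂ (to u)
    a₂ : Adj G₂ (proj₂ (to z)) (proj₂ (to u))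
    a₂ = □-adj₂ {G₁} {G₂} (adj⇒ zu) s
    a₁ : Adj G₁ (proj₁ (to z)) (proj₁ (to w))
    a₁ = □-adj₁ {G₁} {G₂} (adj⇒ zw) t

  Parallel : V G → V G → V G → V G → Set
  Parallel a b c d = Same₁ a b ⇔ Same₁ c d

  opposite-edge : ∀ {a b c d} → Adj G a b → Adj G a c → Adj G b d → Adj G c d →
                  b ≢ c → a ≢ d → Same₁ a b → Same₁ c d
  opposite-edge ab ac bd cd b≢c a≢d s-ab with edge-direction cd
  ... | inj₁ s-cd = s-cd
  ... | inj₂ t-cd with edge-direction ac | edge-direction bd
  ...   | inj₁ s-ac | inj₁ s-bd =
          ⊥-elim (edge-direction-unique cd (trans (trans (sym s-ac) s-ab) s-bd) t-cd)
  ...   | inj₁ s-ac | inj₂ t-bd =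
          ⊥-elim (b≢c (same-coordinates (trans (sym s-ab) s-ac) (trans t-bd (sym t-cd))))
  ...   | inj₂ t-ac | inj₁ s-bd =
          ⊥-elim (a≢d (same-coordinates (trans s-ab s-bd) (trans t-ac t-cd)))
  ...   | inj₂ t-ac | inj₂ t-bd =
          ⊥-elim (edge-direction-unique ab s-ab (trans (trans t-ac t-cd) (sym t-bd)))

  opposite-parallel : ∀ {a b c d} → Adj G a b → Adj G a c → Adj G b d → Adj G c d →
                      b ≢ c → a ≢ d → Parallel a b c d
  opposite-parallel ab ac bd cd b≢c a≢d =
    mk⇔ (opposite-edge ab ac bd cd b≢c a≢d)
        (opposite-edge cd (adj-sym G ac) (adj-sym G bd) ab (λ e → a≢d (sym e)) (λ e → b≢c (sym e)))

  parallel-Same₂ : ∀ {a b c d} → Adj G a b → Adj G c d → Parallel a b c d → Same₂ a b → Same₂ c d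
  parallel-Same₂ ab cd par t-ab with edge-direction cd
  ... | inj₂ t-cd = t-cd
  ... | inj₁ s-cd = ⊥-elim (edge-direction-unique ab (Equivalence.from par s-cd) t-ab)

  Differ : V G → V G → V G → Set
  Differ z u w = (Same₁ z u × Same₂ z w) ⊎ (Same₂ z u × Same₁ z w)

  differ-parallel : ∀ {z u w z′ u′ w′} → Adj G z u → Adj G z w → Adj G z′ u′ → Adj G z′ w′ →
                    Parallel z u z′ u′ → Parallel z w z′ w′ → Differ z u w → Differ z′ u′ w′
  differ-parallel zu zw zu′ zw′ pu pw (inj₁ (s , t)) =
    inj₁ (Equivalence.to pu s , parallel-Same₂ zw zw′ pw t)
  differ-parallel zu zw zu′ zw′ pu pw (inj₂ (t , s)) =
    inj₂ (parallel-Same₂ zu zu′ pu t , Equivalence.to pw s)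

hamming-refl : ∀ {n} (w : Vec Bool n) → hamming w w ≡ 0
hamming-refl []          = refl
hamming-refl (true ∷ w)  = hamming-refl w
hamming-refl (false ∷ w) = hamming-refl w

hamming≡0 : ∀ {n} (u v : Vec Bool n) → hamming u v ≡ 0 → u ≡ v
hamming≡0 []          []          _ = refl
hamming≡0 (true ∷ u)  (true ∷ v)  e = cong (true ∷_) (hamming≡0 u v e)
hamming≡0 (false ∷ u) (false ∷ v) e = cong (false ∷_) (hamming≡0 u v e)
hamming≡0 (true ∷ u)  (false ∷ v) ()
hamming≡0 (false ∷ u) (true ∷ v)  ()

module _ {n} {u v : Vec Bool n} where
  private
    Cases : Bool → Bool → Set
    Cases a b = (a ≡ b × hamming u v ≡ 1) ⊎ (u ≡ v × a ≢ b)

  same-head : ∀ {a} → hamming u v ≡ 1 ⇔ Cases a a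
  same-head = mk⇔ (λ h → inj₁ (refl , h))
                  λ { (inj₁ (_ , h)) → h ; (inj₂ (_ , a≢a)) → ⊥-elim (a≢a refl) }

  other-head : ∀ {a b} → a ≢ b → suc (hamming u v) ≡ 1 ⇔ Cases a b
  other-head a≢b = mk⇔ (λ h → inj₂ (hamming≡0 u v (suc-injective h) , a≢b))
                       λ { (inj₁ (a≡b , _)) → ⊥-elim (a≢b a≡b)
                         ; (inj₂ (refl , _)) → cong suc (hamming-refl u) }

hamming-cons : ∀ {n} a b (u v : Vec Bool n) →
               hamming (a ∷ u) (b ∷ v) ≡ 1 ⇔ ((a ≡ b × hamming u v ≡ 1) ⊎ (u ≡ v × a ≢ b))
hamming-cons true  true  u v = same-head
hamming-cons false false u v = same-head
hamming-cons true  false u v = other-head λ ()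
hamming-cons false true  u v = other-head λ ()

zeros : ∀ n → Vec Bool n
zeros n = replicate n false

hamming-set : ∀ {n} (w : Vec Bool n) i → lookup w i ≡ false → hamming w (w [ i ]≔ true) ≡ 1
hamming-set (false ∷ w) zero    refl = cong suc (hamming-refl w)
hamming-set (x ∷ w)     (suc i) l    =
  Equivalence.from (hamming-cons x x w (w [ i ]≔ true)) (inj₁ (refl , hamming-set w i l))

neighbours-of-zeros : ∀ {n} (y : Vec Bool n) → hamming (zeros n) y ≡ 1 →
                      ∃ λ i → y ≡ zeros n [ i ]≔ true
neighbours-of-zeros (false ∷ y) h with Equivalence.to (hamming-cons false false (zeros _) y) h
... | inj₁ (_ , h′) = let (i , e) = neighbours-of-zeros y h′ in suc i , cong (false ∷_) e
... | inj₂ (_ , f≢f) = ⊥-elim (f≢f refl)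
neighbours-of-zeros (true ∷ y) h with Equivalence.to (hamming-cons false true (zeros _) y) h
... | inj₁ (() , _)
... | inj₂ (refl , _) = zero , refl

distinct-units : ∀ {n} (z : Vec Bool n) {i j} → i ≢ j → lookup z i ≡ false →
                 z [ i ]≔ true ≢ z [ j ]≔ true
distinct-units z {i} {j} i≢j zi e with
  trans (sym (lookup∘update i z true))
        (trans (cong (λ w → lookup w i) e) (trans (lookup∘update′ i≢j z true) zi))
... | ()

common-neighbours : ∀ {n} (z y : Vec Bool n) {i j} → i ≢ j →
  lookup z i ≡ false → lookup z j ≡ false →
  hamming (z [ i ]≔ true) y ≡ 1 → hamming (z [ j ]≔ true) y ≡ 1 →
  y ≡ z ⊎ y ≡ (z [ i ]≔ true) [ j ]≔ true
common-neighbours (x ∷ z) (c ∷ y) {zero} {zero} i≢j _ _ _ _ = ⊥-elim (i≢j refl)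
common-neighbours (false ∷ z) (c ∷ y) {zero} {suc j} _ _ _ hi hj
  with Equivalence.to (hamming-cons true c z y) hi
... | inj₂ (refl , t≢c) = inj₁ (cong (_∷ z) (¬-not (λ e → t≢c (sym e))))
... | inj₁ (refl , _) with Equivalence.to (hamming-cons false true (z [ j ]≔ true) y) hj
...   | inj₁ (() , _)
...   | inj₂ (refl , _) = inj₂ refl
common-neighbours (false ∷ z) (c ∷ y) {suc i} {zero} _ _ _ hi hj
  with Equivalence.to (hamming-cons true c z y) hj
... | inj₂ (refl , t≢c) = inj₁ (cong (_∷ z) (¬-not (λ e → t≢c (sym e))))
... | inj₁ (refl , _) with Equivalence.to (hamming-cons false true (z [ i ]≔ true) y) hi
...   | inj₁ (() , _)
...   | inj₂ (refl , _) = inj₂ refl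
common-neighbours (x ∷ z) (c ∷ y) {suc i} {suc j} i≢j zi zj hi hj
  with Equivalence.to (hamming-cons x c (z [ i ]≔ true) y) hi
     | Equivalence.to (hamming-cons x c (z [ j ]≔ true) y) hj
... | inj₁ (refl , hi′) | inj₁ (_ , hj′) =
      Data.Sum.map (cong (x ∷_)) (cong (x ∷_))
        (common-neighbours z y (λ e → i≢j (cong suc e)) zi zj hi′ hj′)
... | inj₁ (refl , _) | inj₂ (_ , x≢x) = ⊥-elim (x≢x refl)
... | inj₂ (_ , x≢c) | inj₁ (x≡c , _) = ⊥-elim (x≢c x≡c)
... | inj₂ (ei , _) | inj₂ (ej , _) =
      ⊥-elim (distinct-units z (λ e → i≢j (cong suc e)) zi (trans ei (sym ej)))

ones : List Bool → ℕ
ones []          = 0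
ones (true ∷ l)  = suc (ones l)
ones (false ∷ l) = ones l

ones-++ : ∀ xs ys → ones (xs ++ ys) ≡ ones xs + ones ys
ones-++ []          ys = refl
ones-++ (true ∷ xs) ys = cong suc (ones-++ xs ys)
ones-++ (false ∷ xs) ys = ones-++ xs ys

ones-falses : ∀ k → ones (List.replicate k false) ≡ 0
ones-falses zero    = refl
ones-falses (suc k) = ones-falses k

ones-prefix : ∀ {xs ys} → Prefix _≡_ xs ys → ones xs ≤ ones ys
ones-prefix Prefix.[] = z≤n
ones-prefix (Prefix._∷_ {true}  refl p) = s≤s (ones-prefix p)
ones-prefix (Prefix._∷_ {false} refl p) = ones-prefix p

ones-infix : ∀ {xs ys} → Infix _≡_ xs ys → ones xs ≤ ones ys
ones-infix (here p)          = ones-prefix p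
ones-infix (there {true}  i) = ≤-trans (ones-infix i) (n≤1+n _)
ones-infix (there {false} i) = ones-infix i

ones-forbidden : ∀ p r → ones (forbidden p r) ≡ suc r
ones-forbidden p r = begin
  ones (runs r ++ [ true ])    ≡⟨ ones-++ (runs r) [ true ] ⟩
  ones (runs r) + 1            ≡⟨ cong (_+ 1) (ones-runs r) ⟩
  r + 1                        ≡⟨ +-comm r 1 ⟩
  suc r                        ∎
  where
  open ≡-Reasoning
  runs : ℕ → List Bool
  runs k = List.concat (List.replicate k (true ∷ List.replicate (p ∸ 1) false))
  ones-runs : ∀ k → ones (runs k) ≡ k
  ones-runs zero    = refl
  ones-runs (suc k) = begin
    ones ((true ∷ List.replicate (p ∸ 1) false) ++ runs k)
      ≡⟨ ones-++ (true ∷ List.replicate (p ∸ 1) false) (runs k) ⟩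
    suc (ones (List.replicate (p ∸ 1) false) + ones (runs k))
      ≡⟨ cong₂ (λ a b → suc (a + b)) (ones-falses (p ∸ 1)) (ones-runs k) ⟩
    suc k ∎

weight : ∀ {n} → Vec Bool n → ℕ
weight w = ones (toList w)

weight-zeros : ∀ n → weight (zeros n) ≡ 0
weight-zeros zero    = refl
weight-zeros (suc n) = weight-zeros n

weight-≤ : ∀ {n} (w : Vec Bool n) → weight w ≤ n
weight-≤ []          = z≤n
weight-≤ (true ∷ w)  = s≤s (weight-≤ w)
weight-≤ (false ∷ w) = ≤-trans (weight-≤ w) (n≤1+n _)

weight-set : ∀ {n} (w : Vec Bool n) i → lookup w i ≡ false → weight (w [ i ]≔ true) ≡ suc (weight w)
weight-set (false ∷ w) zero    refl = refl
weight-set (true ∷ w)  (suc i) l    = cong suc (weight-set w i l)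
weight-set (false ∷ w) (suc i) l    = weight-set w i l

weight-zero : ∀ {n} (w : Vec Bool n) → weight w ≡ 0 → w ≡ zeros n
weight-zero []          _ = refl
weight-zero (false ∷ w) e = cong (false ∷_) (weight-zero w e)

weight-witness : ∀ {n c} (w : Vec Bool n) → weight w ≡ suc c → ∃ λ i → lookup w i ≡ true
weight-witness (true ∷ w)  _ = zero , refl
weight-witness (false ∷ w) e = let (i , l) = weight-witness w e in suc i , l

[]≔-restore : ∀ {n} (x : Vec Bool n) i {b c} → lookup x i ≡ b → (x [ i ]≔ c) [ i ]≔ b ≡ x
[]≔-restore x i {b} {c} l = begin
  (x [ i ]≔ c) [ i ]≔ b   ≡⟨ []≔-idempotent x i ⟩
  x [ i ]≔ b              ≡⟨ cong (x [ i ]≔_) (sym l) ⟩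
  x [ i ]≔ lookup x i     ≡⟨ []≔-lookup x i ⟩
  x                       ∎
  where open ≡-Reasoning

weight-clear : ∀ {n} (w : Vec Bool n) i → lookup w i ≡ true → suc (weight (w [ i ]≔ false)) ≡ weight w
weight-clear w i l = begin
  suc (weight (w [ i ]≔ false))            ≡⟨ sym (weight-set (w [ i ]≔ false) i (lookup∘update i w false)) ⟩
  weight ((w [ i ]≔ false) [ i ]≔ true)    ≡⟨ cong weight ([]≔-restore w i l) ⟩
  weight w                                 ∎
  where open ≡-Reasoning

weight-decompose : ∀ {n c} (z : Vec Bool n) → weight z ≡ suc c →
  ∃₂ λ z′ j → z ≡ z′ [ j ]≔ true × lookup z′ j ≡ false × weight z′ ≡ c
weight-decompose z e with weight-witness z e
... | j , l = z [ j ]≔ false , j , sym ([]≔-restore z j l) , lookup∘update j z false ,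
              suc-injective (trans (weight-clear z j l) e)

Valid : ℕ → ℕ → ∀ {n} → Vec Bool n → Set
Valid p r w = T (isOFib p r (toList w))

isOFib⇔ : ∀ p r l → T (isOFib p r l) ⇔ (T (separated p l) × ¬ Infix _≡_ (forbidden p r) l)
isOFib⇔ p r l = mk⇔
  (λ v → let (s , n) = Equivalence.to T-∧ v in s , toWitnessFalse n)
  (λ (s , n) → Equivalence.from T-∧ (s , fromWitnessFalse n))

-- Words with at most r ones avoid the forbidden factor, which has r + 1 of them.
few-ones-no-run : ∀ p r l → ones l ≤ r → ¬ Infix _≡_ (forbidden p r) l
few-ones-no-run p r l b i =
  <-irrefl refl (≤-trans (subst (_≤ ones l) (ones-forbidden p r) (ones-infix i)) b)

-- The forbidden factor starts with a 1, so it cannot start at a 0.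
no-run-cons0 : ∀ p r l → ¬ Infix _≡_ (forbidden p r) l → ¬ Infix _≡_ (forbidden p r) (false ∷ l)
no-run-cons0 p r l n i = n (skip (forbidden p r) (head-true r) i)
  where
  head-true : ∀ r → ∃ λ rest → forbidden p r ≡ true ∷ rest
  head-true zero    = _ , refl
  head-true (suc r) = _ , refl
  skip : ∀ F → (∃ λ rest → F ≡ true ∷ rest) → Infix _≡_ F (false ∷ l) → Infix _≡_ F l
  skip F (_ , refl) (here (() Prefix.∷ _))
  skip F (_ , refl) (there i) = i

separated-tail : ∀ p b l → T (separated p (b ∷ l)) → T (separated p l)
separated-tail p true  l s = proj₂ (Equivalence.to T-∧ s)
separated-tail p false l s = s

valid-tail : ∀ p r {n} b (w : Vec Bool n) → Valid p r (b ∷ w) → Valid p r w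
valid-tail p r b w v =
  let (s , n) = Equivalence.to (isOFib⇔ p r (b ∷ toList w)) v
  in Equivalence.from (isOFib⇔ p r (toList w)) (separated-tail p b (toList w) s , λ i → n (there i))

valid-cons0 : ∀ p r {n} (w : Vec Bool n) → Valid p r w → Valid p r (false ∷ w)
valid-cons0 p r w v =
  let (s , n) = Equivalence.to (isOFib⇔ p r (toList w)) v
  in Equivalence.from (isOFib⇔ p r (false ∷ toList w)) (s , no-run-cons0 p r (toList w) n)

separated-zeros : ∀ p n → T (separated p (toList (zeros n)))
separated-zeros p zero    = _
separated-zeros p (suc n) = separated-zeros p n

zerosAhead-zeros : ∀ q n → zerosAhead q (toList (zeros n)) ≡ true
zerosAhead-zeros zero    n       = refl
zerosAhead-zeros (suc q) zero    = refl
zerosAhead-zeros (suc q) (suc n) = zerosAhead-zeros q n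

separated-unit : ∀ p n (i : Fin n) → T (separated p (toList (zeros n [ i ]≔ true)))
separated-unit p (suc n) zero    =
  Equivalence.from T-∧ (subst T (sym (zerosAhead-zeros (p ∸ 1) n)) _ , separated-zeros p n)
separated-unit p (suc n) (suc i) = separated-unit p n i

valid-zeros : ∀ p r n → Valid p r (zeros n)
valid-zeros p r n = Equivalence.from (isOFib⇔ p r _)
  (separated-zeros p n , few-ones-no-run p r _ (subst (_≤ r) (sym (weight-zeros n)) z≤n))

valid-unit : ∀ p r n → 1 ≤ r → (i : Fin n) → Valid p r (zeros n [ i ]≔ true)
valid-unit p r n 1≤r i = Equivalence.from (isOFib⇔ p r _)
  (separated-unit p n i , few-ones-no-run p r _ (subst (_≤ r) (sym weight-unit) 1≤r))
  where
  weight-unit : weight (zeros n [ i ]≔ true) ≡ 1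
  weight-unit = trans (weight-set (zeros n) i (lookup-replicate i false)) (cong suc (weight-zeros n))

-- For p = 1 condition (1) is void, so every word of weight at most r is valid.
valid₁ : ∀ r {n} (w : Vec Bool n) → weight w ≤ r → Valid 1 r w
valid₁ r w b = Equivalence.from (isOFib⇔ 1 r _) (separated-one (toList w) , few-ones-no-run 1 r _ b)
  where
  separated-one : ∀ l → T (separated 1 l)
  separated-one []          = _
  separated-one (true ∷ l)  = separated-one l
  separated-one (false ∷ l) = separated-one l

adjacent-ones-unseparated : ∀ {p m} → 2 ≤ p → (w : Vec Bool (suc m)) (i : Fin m) →
  lookup w (inject₁ i) ≡ true → lookup w (suc i) ≡ true → ¬ T (separated p (toList w))
adjacent-ones-unseparated {suc zero} (s≤s ()) _ _ _ _
adjacent-ones-unseparated {suc (suc q)} _ (true ∷ true ∷ w) zero refl refl ()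
adjacent-ones-unseparated 2≤p (a ∷ w) (suc i) l l′ s =
  adjacent-ones-unseparated 2≤p w i l l′ (separated-tail _ a (toList w) s)

-- block n s l: the word of length n whose 1s are exactly at positions s, …, s + l − 1.
block : (n s l : ℕ) → Vec Bool n
block zero    _       _       = []
block (suc n) (suc s) l       = false ∷ block n s l
block (suc n) zero    zero    = false ∷ block n zero zero
block (suc n) zero    (suc l) = true ∷ block n zero l

block-lookup : ∀ {n} s l (t : Fin n) → s ≤ toℕ t → toℕ t < s + l → lookup (block n s l) t ≡ true
block-lookup (suc s) l       (suc t) (s≤s st) (s≤s tl) = block-lookup s l t st tl
block-lookup zero    (suc l) zero    _        _        = refl
block-lookup zero    (suc l) (suc t) _        (s≤s tl) = block-lookup zero l t z≤n tl

block-weight : ∀ n s l → s + l ≤ n → weight (block n s l) ≡ l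
block-weight zero    zero    zero    _       = refl
block-weight (suc n) (suc s) l       (s≤s b) = block-weight n s l b
block-weight (suc n) zero    zero    _       = block-weight n zero zero z≤n
block-weight (suc n) zero    (suc l) (s≤s b) = cong suc (block-weight n zero l b)

-- For p = 1 the forbidden factor is 1^{r+1}, so a block of r + 1 ones is not valid.
block-invalid : ∀ n s r → s + suc r ≤ n → ¬ Valid 1 r (block n s (suc r))
block-invalid n s r b v = proj₂ (Equivalence.to (isOFib⇔ 1 r _) v) (run n s b)
  where
  leading-run : ∀ n {r} → suc r ≤ n → Prefix _≡_ (forbidden 1 r) (toList (block n zero (suc r)))
  leading-run (suc n) {zero}  _       = refl Prefix.∷ Prefix.[]
  leading-run (suc n) {suc r} (s≤s b) = refl Prefix.∷ leading-run n b
  run : ∀ n s → s + suc r ≤ n → Infix _≡_ (forbidden 1 r) (toList (block n s (suc r)))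
  run n       zero    b       = here (leading-run n b)
  run (suc n) (suc s) (s≤s b) = there (run n s b)

module Cube (p r : ℕ) where

  -- The vertex of the O-Fibonacci cube given by a valid word. The validity proof is
  -- irrelevant, so vertices with the same word are definitionally equal.
  vertex : ∀ {n} (w : Vec Bool n) → .(Valid p r w) → V (OFibCube p r n)
  vertex w v = w , recompute (T? _) v

  vertex-unique : ∀ {n} (x : V (OFibCube p r n)) {w} .(v : Valid p r w) →
                  proj₁ x ≡ w → x ≡ vertex w v
  vertex-unique (w , v′) v refl = cong (w ,_) (T-irrelevant v′ _)

  -- Every O-Fibonacci cube is connected: clearing the letters from left to right
  -- walks through valid words to the zero word.
  clear-head : ∀ {n} b (w : Vec Bool n) .(v : Valid p r (b ∷ w)) →
    Walk (OFibCube p r (suc n)) (vertex (b ∷ w) v)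
                                (vertex (false ∷ w) (valid-cons0 p r w (valid-tail p r b w v)))
  clear-head false w v = ε
  clear-head true  w v = cong suc (hamming-refl w) ◅ ε

  walk-to-zeros : ∀ {n} (w : Vec Bool n) .(v : Valid p r w) →
                  Walk (OFibCube p r n) (vertex w v) (vertex (zeros n) (valid-zeros p r n))
  walk-to-zeros []      v = ε
  walk-to-zeros {suc n} (b ∷ w) v =
    clear-head b w v ◅◅ gmap prepend0 (λ a → a) (walk-to-zeros w (valid-tail p r b w v))
    where
    prepend0 : V (OFibCube p r n) → V (OFibCube p r (suc n))
    prepend0 (u , vu) = vertex (false ∷ u) (valid-cons0 p r u vu)

  cube-connected : ∀ n → Connected (OFibCube p r n)
  cube-connected n x y =
    to-zeros x ◅◅ reverse (λ {x} {y} → adj-sym (OFibCube p r n) {x} {y}) (to-zeros y)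
    where
    to-zeros : ∀ x → Walk (OFibCube p r n) x (vertex (zeros n) (valid-zeros p r n))
    to-zeros x = subst (λ x → Walk (OFibCube p r n) x _) (sym (vertex-unique x (proj₂ x) refl))
                       (walk-to-zeros (proj₁ x) (proj₂ x))

ChangeAt : ∀ {m} (P Q : Fin (suc m) → Set) → Fin m → Set
ChangeAt P Q i = (P (inject₁ i) × Q (suc i)) ⊎ (Q (inject₁ i) × P (suc i))

change-later : ∀ {m} {P Q : Fin (suc (suc m)) → Set} →
               ∃ (ChangeAt (λ i → P (suc i)) (λ i → Q (suc i))) → ∃ (ChangeAt P Q)
change-later (i , c) = suc i , c

change-point : ∀ {m} (P Q : Fin (suc m) → Set) → (∀ i → P i ⊎ Q i) → (∀ i → P i → Q i → ⊥) →
               ∀ {a b} → P a → Q b → ∃ (ChangeAt P Q)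
change-point P Q cover disjoint {zero} {zero} pa qb = ⊥-elim (disjoint zero pa qb)
change-point {suc m} P Q cover disjoint {zero} {suc b} p₀ qb with cover (suc zero)
... | inj₂ q₁ = zero , inj₁ (p₀ , q₁)
... | inj₁ p₁ =
  change-later {P = P} {Q} (change-point _ _ (cover ∘ suc) (disjoint ∘ suc) p₁ qb)
change-point {suc m} P Q cover disjoint {suc a} {zero} pa q₀ with cover (suc zero)
... | inj₁ p₁ = zero , inj₂ (q₀ , p₁)
... | inj₂ q₁ =
  change-later {P = P} {Q} (change-point _ _ (cover ∘ suc) (disjoint ∘ suc) pa q₁)
change-point {suc m} P Q cover disjoint {suc a} {suc b} pa qb =
  change-later {P = P} {Q} (change-point _ _ (cover ∘ suc) (disjoint ∘ suc) pa qb)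

-- For k < m and 1 ≤ r ≤ m there is a window s, …, s + r inside 0, …, m containing
-- k and k + 1; s = min k (m − r) will do.
window : ∀ {k m r} → k < m → 1 ≤ r → r ≤ m →
         ∃ λ s → s ≤ k × suc k < s + suc r × s + suc r ≤ suc m
window {k} {m} {r} k<m 1≤r r≤m =
  s , m⊓n≤m k (m ∸ r) ,
  subst (suc k <_) (sym (+-suc s r)) (s≤s (subst (suc k ≤_) (sym s+r) (⊓-glb k+1≤k+r k<m))) ,
  subst (_≤ suc m) (sym (+-suc s r)) (s≤s (subst (_≤ m) (sym s+r) (m⊓n≤n (k + r) m)))
  where
  s = k ⊓ (m ∸ r)
  s+r : s + r ≡ (k + r) ⊓ m
  s+r = trans (+-distribʳ-⊓ r k (m ∸ r)) (cong ((k + r) ⊓_) (m∸n+n≡m r≤m))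
  k+1≤k+r : suc k ≤ k + r
  k+1≤k+r = subst (_≤ k + r) (+-comm k 1) (+-monoʳ-≤ k 1≤r)

holes : ∀ {n} → Vec Bool n → Fin n → Fin n → Vec Bool n
holes x a b = (x [ a ]≔ false) [ b ]≔ false

holes-at-a : ∀ {n} (x : Vec Bool n) {a b} → a ≢ b → lookup (holes x a b) a ≡ false
holes-at-a x {a} a≢b = trans (lookup∘update′ a≢b (x [ a ]≔ false) false) (lookup∘update a x false)

holes-at-b : ∀ {n} (x : Vec Bool n) {a} b → lookup (holes x a b) b ≡ false
holes-at-b x {a} b = lookup∘update b (x [ a ]≔ false) false

module _ {n} (x : Vec Bool n) {a b : Fin n} (a≢b : a ≢ b) (xa : lookup x a ≡ true)
         (xb : lookup x b ≡ true) where

  holes-weight : suc (suc (weight (holes x a b))) ≡ weight x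
  holes-weight = begin
    suc (suc (weight (holes x a b)))  ≡⟨ cong suc (weight-clear (x [ a ]≔ false) b xb′) ⟩
    suc (weight (x [ a ]≔ false))     ≡⟨ weight-clear x a xa ⟩
    weight x                          ∎
    where
    open ≡-Reasoning
    xb′ : lookup (x [ a ]≔ false) b ≡ true
    xb′ = trans (lookup∘update′ (λ e → a≢b (sym e)) x false) xb

  holes-fill : (holes x a b [ a ]≔ true) [ b ]≔ true ≡ x
  holes-fill = begin
    (((x [ a ]≔ false) [ b ]≔ false) [ a ]≔ true) [ b ]≔ true
      ≡⟨ cong (_[ b ]≔ true) ([]≔-commutes (x [ a ]≔ false) b a (λ e → a≢b (sym e))) ⟩
    (((x [ a ]≔ false) [ a ]≔ true) [ b ]≔ false) [ b ]≔ true
      ≡⟨ cong (λ y → (y [ b ]≔ false) [ b ]≔ true) ([]≔-restore x a xa) ⟩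
    (x [ b ]≔ false) [ b ]≔ true
      ≡⟨ []≔-restore x b xb ⟩
    x ∎
    where open ≡-Reasoning

inject₁≢suc : ∀ {m} (i : Fin m) → inject₁ i ≢ suc i
inject₁≢suc i = <⇒≢ᶠ (≤̄⇒inject₁< ≤-refl)

module Forward {p r m : ℕ} (1≤r : 1 ≤ r) {G₁ G₂ : Graph} (φ : OFibCube p r (suc m) ≅ (G₁ □ G₂))
               (nt₁ : Nontrivial G₁) (nt₂ : Nontrivial G₂) where
  open ProductStructure {OFibCube p r (suc m)} {G₁} {G₂} φ
  open Cube p r

  n : ℕ
  n = suc m

  G : Graph
  G = OFibCube p r n

  origin : V G
  origin = vertex (zeros n) (valid-zeros p r n)

  unit : Fin n → V G
  unit i = vertex (zeros n [ i ]≔ true) (valid-unit p r n 1≤r i)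

  origin-unit : ∀ i → Adj G origin (unit i)
  origin-unit i = hamming-set (zeros n) i (lookup-replicate i false)

  -- Some two consecutive unit edges at the origin have different directions: both
  -- directions occur at the origin, and its neighbours are the unit words.
  origin-change : ∃ λ (i : Fin m) → Differ origin (unit (inject₁ i)) (unit (suc i))
  origin-change =
    let ((u , ou , s) , (w , ow , t)) = both-directions (cube-connected n) nt₁ nt₂ origin
        (a , ua) = neighbours-of-zeros (proj₁ u) ou
        (b , wb) = neighbours-of-zeros (proj₁ w) ow
    in change-point (λ i → Same₁ origin (unit i)) (λ i → Same₂ origin (unit i))
                    (λ i → edge-direction (origin-unit i)) (λ i → edge-direction-unique (origin-unit i))
                    (subst (Same₁ origin) (vertex-unique u (valid-unit p r n 1≤r a) ua) s)
                    (subst (Same₂ origin) (vertex-unique w (valid-unit p r n 1≤r b) wb) t)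

  i₀ : Fin m
  i₀ = proj₁ origin-change

  a b : Fin n
  a = inject₁ i₀
  b = suc i₀

  a≢b : a ≢ b
  a≢b = inject₁≢suc i₀

  -- A change position exists, so n ≥ 2.
  dimension-≥2 : 2 ≤ n
  dimension-≥2 = s≤s (≤-trans (s≤s z≤n) (toℕ<n i₀))

  fourth-corner : ∀ (z : Vec Bool n) {i j} → i ≢ j → lookup z i ≡ false → lookup z j ≡ false →
    .(vz : Valid p r z) (y : V G) →
    hamming (z [ i ]≔ true) (proj₁ y) ≡ 1 → hamming (z [ j ]≔ true) (proj₁ y) ≡ 1 →
    y ≢ vertex z vz → Valid p r ((z [ i ]≔ true) [ j ]≔ true)
  fourth-corner z i≢j zi zj vz y uy wy y≢z with common-neighbours z (proj₁ y) i≢j zi zj uy wy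
  ... | inj₁ y≡z = ⊥-elim (y≢z (vertex-unique y vz y≡z))
  ... | inj₂ y≡d = subst (Valid p r) y≡d (proj₂ y)

  -- If the edges z — z + eᵢ and z — z + eⱼ have different directions, they span a
  -- square, whose fourth corner can only be z + eᵢ + eⱼ.
  differ-completes : ∀ (z : Vec Bool n) {i j} → i ≢ j → lookup z i ≡ false → lookup z j ≡ false →
    .(vz : Valid p r z) .(vi : Valid p r (z [ i ]≔ true)) .(vj : Valid p r (z [ j ]≔ true)) →
    Differ (vertex z vz) (vertex (z [ i ]≔ true) vi) (vertex (z [ j ]≔ true) vj) →
    Valid p r ((z [ i ]≔ true) [ j ]≔ true)
  differ-completes z {i} {j} i≢j zi zj vz _ _ (inj₁ (s , t)) =
    let (y , uy , wy , y≢z) = square (hamming-set z i zi) (hamming-set z j zj) s t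
    in fourth-corner z i≢j zi zj vz y uy wy y≢z
  differ-completes z {i} {j} i≢j zi zj vz _ _ (inj₂ (t , s)) =
    let (y , wy , uy , y≢z) = square (hamming-set z j zj) (hamming-set z i zi) s t
    in fourth-corner z i≢j zi zj vz y uy wy y≢z

  face-parallel : ∀ (z : Vec Bool n) {j k} → j ≢ k → lookup z j ≡ false → lookup z k ≡ false →
    .(v₀ : Valid p r z) .(v₁ : Valid p r (z [ k ]≔ true)) .(v₂ : Valid p r (z [ j ]≔ true))
    .(v₃ : Valid p r ((z [ j ]≔ true) [ k ]≔ true)) →
    Parallel (vertex z v₀) (vertex (z [ k ]≔ true) v₁)
             (vertex (z [ j ]≔ true) v₂) (vertex ((z [ j ]≔ true) [ k ]≔ true) v₃)
  face-parallel z {j} {k} j≢k zj zk v₀ _ _ v₃ =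
    opposite-parallel (hamming-set z k zk) (hamming-set z j zj) bd cd
      (λ e → distinct-units z k≢j zk (cong proj₁ e)) a≢d
    where
    k≢j : k ≢ j
    k≢j e = j≢k (sym e)
    bd : hamming (z [ k ]≔ true) ((z [ j ]≔ true) [ k ]≔ true) ≡ 1
    bd = subst (λ w → hamming (z [ k ]≔ true) w ≡ 1) ([]≔-commutes z k j k≢j)
               (hamming-set (z [ k ]≔ true) j (trans (lookup∘update′ j≢k z true) zj))
    cd : hamming (z [ j ]≔ true) ((z [ j ]≔ true) [ k ]≔ true) ≡ 1
    cd = hamming-set (z [ j ]≔ true) k (trans (lookup∘update′ k≢j z true) zk)
    a≢d : vertex z v₀ ≢ vertex ((z [ j ]≔ true) [ k ]≔ true) v₃
    a≢d e with trans (sym zk) (trans (cong (λ x → lookup (proj₁ x) k) e)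
                                     (lookup∘update k (z [ j ]≔ true) true))
    ... | ()

  -- For p ≥ 2 the square at the origin would contain the two adjacent 1s at a and b.
  separation-forbids-products : 2 ≤ p → ⊥
  separation-forbids-products 2≤p =
    adjacent-ones-unseparated 2≤p d i₀ d-at-a d-at-b
      (proj₁ (Equivalence.to (isOFib⇔ p r _) d-valid))
    where
    d = (zeros n [ a ]≔ true) [ b ]≔ true
    d-valid : Valid p r d
    d-valid = differ-completes (zeros n) a≢b (lookup-replicate a false) (lookup-replicate b false)
                (valid-zeros p r n) (valid-unit p r n 1≤r a) (valid-unit p r n 1≤r b)
                (proj₂ origin-change)
    d-at-a : lookup d a ≡ true
    d-at-a = trans (lookup∘update′ a≢b (zeros n [ a ]≔ true) true) (lookup∘update a (zeros n) true)
    d-at-b : lookup d b ≡ true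
    d-at-b = lookup∘update b (zeros n [ a ]≔ true) true

-- The case p = 1, where validity only bounds the number of consecutive 1s.
module ForwardOne {r m : ℕ} (1≤r : 1 ≤ r) {G₁ G₂ : Graph} (φ : OFibCube 1 r (suc m) ≅ (G₁ □ G₂))
                  (nt₁ : Nontrivial G₁) (nt₂ : Nontrivial G₂) where
  open ProductStructure {OFibCube 1 r (suc m)} {G₁} {G₂} φ
  open Cube 1 r
  open Forward 1≤r {G₁} {G₂} φ nt₁ nt₂

  word : (w : Vec Bool n) → .(weight w ≤ r) → V G
  word w ≤r = vertex w (valid₁ r w ≤r)

  set-bound : ∀ (z : Vec Bool n) {k} → lookup z k ≡ false → weight z < r →
              weight (z [ k ]≔ true) ≤ r
  set-bound z {k} zk <r = subst (_≤ r) (sym (weight-set z k zk)) <r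

  -- The direction of the edge z — z + eₖ does not depend on z (of weight < r): remove
  -- the 1s of z one at a time, each step crossing a square face of the cube.
  transport : ∀ {c} (z : Vec Bool n) {k} → weight z ≡ c →
              (zk : lookup z k ≡ false) (<r : weight z < r) →
              Parallel origin (unit k) (word z (<⇒≤ <r)) (word (z [ k ]≔ true) (set-bound z zk <r))
  transport {zero} z wz zk <r with weight-zero z wz
  ... | refl = ⇔-id _
  transport {suc c} z {k} wz zk <r with weight-decompose z wz
  ... | z′ , j , refl , z′j , wz′ =
    face-parallel z′ j≢k z′j z′k (valid₁ r z′ (<⇒≤ <r′)) (valid₁ r _ (set-bound z′ z′k <r′))
                  (valid₁ r _ (<⇒≤ <r)) (valid₁ r _ (set-bound z zk <r))
    ⇔-∘ transport z′ wz′ z′k <r′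
    where
    j≢k : j ≢ k
    j≢k refl with trans (sym (lookup∘update j z′ true)) zk
    ... | ()
    z′k : lookup z′ k ≡ false
    z′k = trans (sym (lookup∘update′ (λ e → j≢k (sym e)) z′ true)) zk
    <r′ : weight z′ < r
    <r′ = <-trans (n<1+n _) (subst (_< r) (weight-set z′ j z′j) <r)

  -- At every word Z of weight r − 1 vanishing at a and b, the edges towards Z + e_a and
  -- Z + e_b are parallel to those at the origin, so they differ in direction and
  -- Z + e_a + e_b must be valid.
  change-everywhere : ∀ (Z : Vec Bool n) → lookup Z a ≡ false → lookup Z b ≡ false →
                      suc (weight Z) ≡ r →
                      Valid 1 r ((Z [ a ]≔ true) [ b ]≔ true)
  change-everywhere Z Za Zb wZ =
    differ-completes Z a≢b Za Zb (valid₁ r Z (<⇒≤ <r)) (valid₁ r _ (set-bound Z Za <r))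
      (valid₁ r _ (set-bound Z Zb <r))
      (differ-parallel (origin-unit a) (origin-unit b) (hamming-set Z a Za) (hamming-set Z b Zb)
        (transport Z refl Za <r) (transport Z refl Zb <r) (proj₂ origin-change))
    where
    <r : weight Z < r
    <r = ≤-reflexive wZ

  -- A block of r + 1 ones around a and b that fits into the word is impossible:
  -- punching holes at a and b gives a word Z as above, while Z + e_a + e_b is the
  -- invalid block.
  block-around-change : ∀ s → s ≤ toℕ i₀ → suc (toℕ i₀) < s + suc r → s + suc r ≤ n → ⊥
  block-around-change s s≤i₀ i₀+1<end end≤n =
    block-invalid n s r end≤n (subst (Valid 1 r) (holes-fill x a≢b xa xb)
      (change-everywhere (holes x a b) (holes-at-a x a≢b) (holes-at-b x b)
        (suc-injective (trans (holes-weight x a≢b xa xb) (block-weight n s (suc r) end≤n)))))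
    where
    x = block n s (suc r)
    xa : lookup x a ≡ true
    xa = block-lookup s (suc r) a (subst (s ≤_) (sym (toℕ-inject₁ i₀)) s≤i₀)
           (subst (_< s + suc r) (sym (toℕ-inject₁ i₀)) (<-trans (n<1+n _) i₀+1<end))
    xb : lookup x b ≡ true
    xb = block-lookup s (suc r) b (≤-trans s≤i₀ (n≤1+n _)) i₀+1<end

  -- Such a block fits as soon as r < n.
  long-run-impossible : r ≤ m → ⊥
  long-run-impossible r≤m =
    let (s , s≤i₀ , i₀+1<end , end≤n) = window (toℕ<n i₀) 1≤r r≤m
    in block-around-change s s≤i₀ i₀+1<end end≤n

  r≥n : r ≥ n
  r≥n = ≮⇒≥ (λ r<n → long-run-impossible (≤-pred r<n))

K₂ : Graph
K₂ = record { V = Bool ; Adj = _≢_ ; adj-sym = λ a≢b b≡a → a≢b (sym b≡a) ; irrefl = λ a≢a → a≢a refl }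

-- If m + 1 ≤ r, every word of length m + 1 is a vertex of the cube with p = 1, which
-- is thus the hypercube and splits off its first coordinate: it is K₂ □ (cube of
-- dimension m).
cube-splits : ∀ r m → suc m ≤ r → OFibCube 1 r (suc m) ≅ (K₂ □ OFibCube 1 r m)
cube-splits r m m+1≤r = ↔⇒⤖ (mk↔ₛ′ split join split∘join join∘split) , adjacency
  where
  open Cube 1 r
  short : ∀ {k} (w : Vec Bool k) → k ≤ r → Valid 1 r w
  short w k≤r = valid₁ r w (≤-trans (weight-≤ w) k≤r)

  split : V (OFibCube 1 r (suc m)) → Bool × V (OFibCube 1 r m)
  split (c ∷ w , _) = c , vertex w (short w (≤-trans (n≤1+n m) m+1≤r))

  join : Bool × V (OFibCube 1 r m) → V (OFibCube 1 r (suc m))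
  join (c , (w , _)) = vertex (c ∷ w) (short (c ∷ w) m+1≤r)

  split∘join : ∀ q → split (join q) ≡ q
  split∘join (c , x) = cong (c ,_) (sym (vertex-unique x _ refl))

  join∘split : ∀ x → join (split x) ≡ x
  join∘split x@(_ ∷ _ , _) = sym (vertex-unique x _ refl)

  adjacency : ∀ x y → Adj (OFibCube 1 r (suc m)) x y ⇔ Adj (K₂ □ OFibCube 1 r m) (split x) (split y)
  adjacency (c ∷ u , _) (d ∷ w , _) =
    mk⇔ (λ h → Data.Sum.map₂ (Data.Product.map₁ (λ { refl → refl }))
                 (Equivalence.to (hamming-cons c d u w) h))
        (λ h → Equivalence.from (hamming-cons c d u w)
                 (Data.Sum.map₂ (Data.Product.map₁ (cong proj₁)) h))

product⇒conditions : ∀ p r n → 1 ≤ p → 1 ≤ r → 1 ≤ n →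
                     NontrivialProduct (OFibCube p r n) → p ≡ 1 × r ≥ n × n ≥ 2
product⇒conditions (suc zero) r (suc m) _ 1≤r _ (G₁ , G₂ , nt₁ , nt₂ , φ) =
  refl , ForwardOne.r≥n 1≤r {G₁} {G₂} φ nt₁ nt₂ , Forward.dimension-≥2 1≤r {G₁} {G₂} φ nt₁ nt₂
product⇒conditions (suc (suc q)) r (suc m) _ 1≤r _ (G₁ , G₂ , nt₁ , nt₂ , φ) =
  ⊥-elim (Forward.separation-forbids-products 1≤r {G₁} {G₂} φ nt₁ nt₂ (s≤s (s≤s z≤n)))

conditions⇒product : ∀ p r n → p ≡ 1 × r ≥ n × n ≥ 2 → NontrivialProduct (OFibCube p r n)
conditions⇒product .1 r (suc zero)    (refl , _ , s≤s ())
conditions⇒product .1 r (suc (suc k)) (refl , n≤r , _) =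
  K₂ , OFibCube 1 r (suc k) , (true , false , λ ()) ,
  (vertex (zeros (suc k)) (valid-zeros 1 r (suc k)) ,
   vertex (zeros (suc k) [ zero ]≔ true) (valid-unit 1 r (suc k) (≤-trans (s≤s z≤n) n≤r) zero) ,
   λ ()) ,
  cube-splits r (suc k) n≤r
  where open Cube 1 r

theorem1p4 : (p r n : ℕ) → 1 ≤ p → 1 ≤ r → 1 ≤ n →
    NontrivialProduct (OFibCube p r n) ⇔ (p ≡ 1 × r ≥ n × n ≥ 2)
theorem1p4 p r n 1≤p 1≤r 1≤n = mk⇔ (product⇒conditions p r n 1≤p 1≤r 1≤n) (conditions⇒product p r n)
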